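{- Let $H$ be a bipartite graph with parts $U$ and $W$, and let $g\in\mathbb{N}$. Then $H$ has girth at least $2g+2$ if and only if for every set $\{u_1,\dots,u_j\}\subseteq U$ of $j\leq g$ distinct vertices, $$|N(u_1,\dots,u_j)|\geq \left(\sum_{i=1}^{j}|N(u_i)|\right)-(j-1),$$ where $N(u_1,\dots,u_j)=\bigcup_{i=1}^j N(u_i)$.
   Context: $N(v)$ is the neighbourhood of $v$ in $H$. The girth of a graph is the length of its shortest cycle (infinite if acyclic). -}

module Defs where

open import Data.Nat using (ℕ; zero; suc; _+_; _≤_)
open import Data.Fin using (Fin; zero; suc; inject₁; fromℕ)
open import Data.Fin.Subset using (Subset; _∈_; ∣_∣; ⋃)
open import Data.Sum using (_⊎_; inj₁; inj₂)
open import Data.Empty using (⊥)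
open import Data.Vec.Functional using (Vector; toList; map; foldr)
open import Function using (_∘_)
open import Function.Definitions using (Injective)
open import Relation.Binary.PropositionalEquality using (_≡_)

-- A finite bipartite graph H with parts U = Fin m and W = Fin n, given by the
-- neighbourhood N(u) ⊆ W of every u ∈ U.
record BipGraph (m n : ℕ) : Set where
  field
    N : Fin m → Subset n

open BipGraph public

Vertex : ℕ → ℕ → Set
Vertex m n = Fin m ⊎ Fin n

Adj : ∀ {m n} → BipGraph m n → Vertex m n → Vertex m n → Set
Adj H (inj₁ u) (inj₂ w) = w ∈ N H u
Adj H (inj₂ w) (inj₁ u) = w ∈ N H u
Adj H (inj₁ _) (inj₁ _) = ⊥
Adj H (inj₂ _) (inj₂ _) = ⊥

-- A cycle of length (suc l): distinct vertices c 0, …, c l (l ≥ 2) with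
-- c i ~ c (i+1) and c l ~ c 0.
record IsCycle {m n : ℕ} (H : BipGraph m n) (l : ℕ) (c : Fin (suc l) → Vertex m n) : Set where
  field
    long     : 2 ≤ l
    distinct : Injective _≡_ _≡_ c
    step     : (i : Fin l) → Adj H (c (inject₁ i)) (c (suc i))
    close    : Adj H (c (fromℕ l)) (c zero)

-- girth(H) ≥ L : every cycle has length at least L (vacuous if acyclic)
GirthAtLeast : ∀ {m n} → BipGraph m n → ℕ → Set
GirthAtLeast {m} {n} H L =
  (l : ℕ) (c : Fin (suc l) → Vertex m n) → IsCycle H l c → L ≤ suc l

NUnion : ∀ {m n j} → BipGraph m n → Vector (Fin m) j → Subset n
NUnion H us = ⋃ (toList (map (N H) us))

degSum : ∀ {m n j} → BipGraph m n → Vector (Fin m) j → ℕ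
degSum H us = foldr _+_ 0 (map (∣_∣ ∘ N H) us)

module Submission where

-- Call ∑ |N(uᵢ)| − |⋃ N(uᵢ)| the excess of the family.  Adjoining a set p to a
-- family with union T raises the excess by exactly |p ∩ T| (inclusion–exclusion).
--
-- (⇒) By induction on j.  If every uᵢ shared two neighbours with the others,
-- one could walk u → w → u' → w' → … through shared neighbours without ever
-- stepping straight back; after j + 1 visits to U some uᵢ repeats, and the first
-- repetition on this non-backtracking closed walk of length ≤ 2j is a cycle of
-- length ≤ 2j < 2g + 2.  So some uᵢ shares at most one neighbour with the rest,
-- and removing it costs at most one unit of excess.
--
-- (⇐) A cycle of length < 2g + 2 is even, say u₀ w₀ u₁ w₁ … u_r w_r, with
-- 2 ≤ r + 1 ≤ g.  Along the cycle consecutive uᵢ share a neighbour, and u₀ shares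
-- two distinct ones (w₀ and w_r) with the others, so the excess of u₀ … u_r is at
-- least r + 1, violating the inequality for j = r + 1.

open import Defs
open import Data.Nat using (ℕ; zero; suc; _+_; _*_; _∸_; _≤_; _<_; z≤n; s≤s; s≤s⁻¹)
open import Data.Nat.Properties
  using ( ≤-refl; ≤-reflexive; ≤-trans; <-≤-trans; <⇒≤; n≤1+n; m≤n⇒m≤1+n; m<n⇒m<1+n
        ; n<1+n; m≤n+m; ≤⇒≯; ≮⇒≥; n≮n; <-cmp; m<1+n⇒m<n∨m≡n; +-suc; +-comm; +-assoc
        ; +-identityʳ; +-monoʳ-≤; +-monoˡ-≤; +-monoʳ-<; +-cancelˡ-≤; *-suc; suc-injective
        ; m+[n∸m]≡n; anyUpTo?; _≤?_; +-commutativeSemigroup; module ≤-Reasoning )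
open import Data.Nat.GeneralisedArithmetic using (iterate)
open import Data.Fin using (Fin; zero; suc; toℕ; inject₁; fromℕ; fromℕ<; punchIn)
open import Data.Fin.Properties
  using ( toℕ-injective; toℕ<n; toℕ≤pred[n]; toℕ-inject₁; toℕ-fromℕ; toℕ-fromℕ<
        ; punchInᵢ≢i; punchIn-injective; pigeonhole; any? )
  renaming (_≟_ to _≟ᶠ_)
open import Data.Fin.Subset using (Subset; _∈_; ∣_∣; _∪_; _∩_; Nonempty; inside; outside)
open import Data.Fin.Subset.Properties
  using ( x∈p∩q⁺; x∈p∩q⁻; x∈p∪q⁺; x∈p∪q⁻; ∉⊥; ∪-identityʳ; ∪-commutativeMonoid
        ; x∈p⇒∣p-x∣<∣p∣; x∈p∧x≢y⇒x∈p-y )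
open import Data.Vec using ([]; _∷_; here; there)
open import Data.Vec.Functional using (Vector; tail; removeAt)
open import Data.Product using (∃; ∃₂; _×_; _,_; proj₁; proj₂)
import Data.Product as Product
open import Data.Sum using (_⊎_; inj₁; inj₂)
open import Data.Sum.Properties using (inj₁-injective; inj₂-injective; ≡-dec)
open import Data.Empty using (⊥; ⊥-elim)
open import Algebra.Bundles using (CommutativeMonoid)
import Algebra.Properties.CommutativeSemigroup as CommutativeSemigroupProperties
open import Function using (_∘_)
open import Function.Definitions using (Injective)
open import Function.Bundles using (_⇔_; mk⇔)
open import Relation.Nullary using (¬_; yes; no; contradiction)
open import Relation.Binary.Definitions using (tri<; tri≈; tri>)
open import Relation.Binary.PropositionalEquality
  using (_≡_; _≢_; refl; sym; trans; cong; subst; subst₂; ≢-sym; module ≡-Reasoning)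

-- Doubling by structural recursion, so that a walk can be unfolded two steps
-- (one U-vertex and one W-vertex) at a time; its monotonicity and cancellation.
double : ℕ → ℕ
double zero    = zero
double (suc n) = suc (suc (double n))

double-mono-≤ : ∀ {a b} → a ≤ b → double a ≤ double b
double-mono-≤ z≤n       = z≤n
double-mono-≤ (s≤s a≤b) = s≤s (s≤s (double-mono-≤ a≤b))

double-mono-< : ∀ {a b} → a < b → double a < double b
double-mono-< (s≤s a≤b) = s≤s (m≤n⇒m≤1+n (double-mono-≤ a≤b))

double-cancel-< : ∀ {a b} → double a < double b → a < b
double-cancel-< {zero}  {suc b} _              = s≤s z≤n
double-cancel-< {suc a} {suc b} (s≤s (s≤s lt)) = s≤s (double-cancel-< lt)

double-injective : ∀ {a b} → double a ≡ double b → a ≡ b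
double-injective {zero}  {zero}  _  = refl
double-injective {suc a} {suc b} eq =
  cong suc (double-injective (suc-injective (suc-injective eq)))

double-suc : ∀ g → double (suc g) ≡ 2 * g + 2
double-suc zero    = refl
double-suc (suc g) = begin
  2 + double (suc g)   ≡⟨ cong (2 +_) (double-suc g) ⟩
  2 + (2 * g + 2)      ≡⟨ +-assoc 2 (2 * g) 2 ⟨
  2 + 2 * g + 2        ≡⟨ cong (_+ 2) (*-suc 2 g) ⟨
  2 * suc g + 2        ∎
  where open ≡-Reasoning

parity : ∀ l → ∃ λ q → l ≡ double q ⊎ l ≡ suc (double q)
parity zero = zero , inj₁ refl
parity (suc l) with parity l
... | q , inj₁ even = q     , inj₂ (cong suc even)
... | q , inj₂ odd  = suc q , inj₁ (cong suc odd)

-- Position t of Fin (suc l), saturating at l; faithful for t ≤ l.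
clamp : ∀ l → ℕ → Fin (suc l)
clamp l       zero    = zero
clamp zero    (suc t) = zero
clamp (suc l) (suc t) = suc (clamp l t)

toℕ-clamp : ∀ {l t} → t ≤ l → toℕ (clamp l t) ≡ t
toℕ-clamp {l}     {zero}  _         = refl
toℕ-clamp {suc l} {suc t} (s≤s t≤l) = cong suc (toℕ-clamp t≤l)

clamp-at : ∀ {l t} (i : Fin (suc l)) → t ≤ l → toℕ i ≡ t → clamp l t ≡ i
clamp-at i t≤l i≡t = toℕ-injective (trans (toℕ-clamp t≤l) (sym i≡t))

startAtLast : ∀ {A : Set} → (ℕ → A) → ℕ → ℕ → A
startAtLast v l zero    = v l
startAtLast v l (suc t) = v t

∣p∪q∣+∣p∩q∣≡∣p∣+∣q∣ : ∀ {n} (p q : Subset n) → ∣ p ∪ q ∣ + ∣ p ∩ q ∣ ≡ ∣ p ∣ + ∣ q ∣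
∣p∪q∣+∣p∩q∣≡∣p∣+∣q∣ []            []            = refl
∣p∪q∣+∣p∩q∣≡∣p∣+∣q∣ (inside  ∷ p) (inside  ∷ q) = cong suc (begin
  ∣ p ∪ q ∣ + suc ∣ p ∩ q ∣   ≡⟨ +-suc ∣ p ∪ q ∣ ∣ p ∩ q ∣ ⟩
  suc (∣ p ∪ q ∣ + ∣ p ∩ q ∣) ≡⟨ cong suc (∣p∪q∣+∣p∩q∣≡∣p∣+∣q∣ p q) ⟩
  suc (∣ p ∣ + ∣ q ∣)         ≡⟨ +-suc ∣ p ∣ ∣ q ∣ ⟨
  ∣ p ∣ + suc ∣ q ∣           ∎)
  where open ≡-Reasoning
∣p∪q∣+∣p∩q∣≡∣p∣+∣q∣ (inside  ∷ p) (outside ∷ q) = cong suc (∣p∪q∣+∣p∩q∣≡∣p∣+∣q∣ p q)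
∣p∪q∣+∣p∩q∣≡∣p∣+∣q∣ (outside ∷ p) (inside  ∷ q) =
  trans (cong suc (∣p∪q∣+∣p∩q∣≡∣p∣+∣q∣ p q)) (sym (+-suc ∣ p ∣ ∣ q ∣))
∣p∪q∣+∣p∩q∣≡∣p∣+∣q∣ (outside ∷ p) (outside ∷ q) = ∣p∪q∣+∣p∩q∣≡∣p∣+∣q∣ p q

x∈p⇒1≤∣p∣ : ∀ {n} {x : Fin n} {p : Subset n} → x ∈ p → 1 ≤ ∣ p ∣
x∈p⇒1≤∣p∣ x∈p = ≤-trans (s≤s z≤n) (x∈p⇒∣p-x∣<∣p∣ x∈p)

x,y∈p⇒2≤∣p∣ : ∀ {n} {x y : Fin n} {p : Subset n} → x ∈ p → y ∈ p → x ≢ y → 2 ≤ ∣ p ∣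
x,y∈p⇒2≤∣p∣ x∈p y∈p x≢y =
  ≤-trans (s≤s (x∈p⇒1≤∣p∣ (x∈p∧x≢y⇒x∈p-y y∈p (≢-sym x≢y)))) (x∈p⇒∣p-x∣<∣p∣ x∈p)

1≤∣p∣⇒nonempty : ∀ {n} (p : Subset n) → 1 ≤ ∣ p ∣ → Nonempty p
1≤∣p∣⇒nonempty (inside  ∷ p) _     = zero , here
1≤∣p∣⇒nonempty (outside ∷ p) 1≤∣p∣ = Product.map suc there (1≤∣p∣⇒nonempty p 1≤∣p∣)

2≤∣p∣⇒avoid : ∀ {n} (p : Subset n) (f : Fin n) → 2 ≤ ∣ p ∣ → ∃ λ w → w ∈ p × w ≢ f
2≤∣p∣⇒avoid (inside  ∷ p) (suc f) _           = zero , here , λ ()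
2≤∣p∣⇒avoid (inside  ∷ p) zero    (s≤s 1≤∣p∣) =
  Product.map suc (λ w∈p → there w∈p , λ ()) (1≤∣p∣⇒nonempty p 1≤∣p∣)
2≤∣p∣⇒avoid (outside ∷ p) zero    2≤∣p∣       =
  Product.map suc (λ w∈p → there w∈p , λ ()) (1≤∣p∣⇒nonempty p (≤-trans (n≤1+n 1) 2≤∣p∣))
2≤∣p∣⇒avoid (outside ∷ p) (suc f) 2≤∣p∣       =
  Product.map suc (λ (w∈p , w≢f) → there w∈p , λ { refl → w≢f refl }) (2≤∣p∣⇒avoid p f 2≤∣p∣)

-- Excess bookkeeping: adjoining p to a family with union T and degree sum d
-- changes the excess d − ∣T∣ by ∣p ∩ T∣, stated as an upper and a lower bound.
excess-cons-≤ : ∀ {n} (p T : Subset n) {d a b} →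
  d ≤ ∣ T ∣ + a → ∣ p ∩ T ∣ ≤ b → ∣ p ∣ + d ≤ ∣ p ∪ T ∣ + (b + a)
excess-cons-≤ p T {d} {a} {b} d≤ overlap≤ = begin
  ∣ p ∣ + d                   ≤⟨ +-monoʳ-≤ ∣ p ∣ d≤ ⟩
  ∣ p ∣ + (∣ T ∣ + a)         ≡⟨ +-assoc ∣ p ∣ ∣ T ∣ a ⟨
  ∣ p ∣ + ∣ T ∣ + a           ≡⟨ cong (_+ a) (∣p∪q∣+∣p∩q∣≡∣p∣+∣q∣ p T) ⟨
  ∣ p ∪ T ∣ + ∣ p ∩ T ∣ + a   ≤⟨ +-monoˡ-≤ a (+-monoʳ-≤ ∣ p ∪ T ∣ overlap≤) ⟩
  ∣ p ∪ T ∣ + b + a           ≡⟨ +-assoc ∣ p ∪ T ∣ b a ⟩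
  ∣ p ∪ T ∣ + (b + a)         ∎
  where open ≤-Reasoning

excess-cons-≥ : ∀ {n} (p T : Subset n) {d a b} →
  ∣ T ∣ + a ≤ d → b ≤ ∣ p ∩ T ∣ → ∣ p ∪ T ∣ + (b + a) ≤ ∣ p ∣ + d
excess-cons-≥ p T {d} {a} {b} ≤d ≤overlap = begin
  ∣ p ∪ T ∣ + (b + a)         ≡⟨ +-assoc ∣ p ∪ T ∣ b a ⟨
  ∣ p ∪ T ∣ + b + a           ≤⟨ +-monoˡ-≤ a (+-monoʳ-≤ ∣ p ∪ T ∣ ≤overlap) ⟩
  ∣ p ∪ T ∣ + ∣ p ∩ T ∣ + a   ≡⟨ cong (_+ a) (∣p∪q∣+∣p∩q∣≡∣p∣+∣q∣ p T) ⟩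
  ∣ p ∣ + ∣ T ∣ + a           ≡⟨ +-assoc ∣ p ∣ ∣ T ∣ a ⟩
  ∣ p ∣ + (∣ T ∣ + a)         ≤⟨ +-monoʳ-≤ ∣ p ∣ ≤d ⟩
  ∣ p ∣ + d                   ∎
  where open ≤-Reasoning

module _ {m n : ℕ} (H : BipGraph m n) where

  IsU IsW : Vertex m n → Set
  IsU x = ∃ λ u → x ≡ inj₁ u
  IsW x = ∃ λ w → x ≡ inj₂ w

  side : (x : Vertex m n) → IsU x ⊎ IsW x
  side (inj₁ u) = inj₁ (u , refl)
  side (inj₂ w) = inj₂ (w , refl)

  Adj-irrefl : ∀ x → ¬ Adj H x x
  Adj-irrefl (inj₁ _) ()
  Adj-irrefl (inj₂ _) ()

  from-U⇒to-W : ∀ {x y} → Adj H x y → IsU x → IsW y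
  from-U⇒to-W {y = inj₂ w} _  _         = w , refl
  from-U⇒to-W {y = inj₁ _} () (_ , refl)

  from-W⇒to-U : ∀ {x y} → Adj H x y → IsW x → IsU y
  from-W⇒to-U {y = inj₁ u} _  _         = u , refl
  from-W⇒to-U {y = inj₂ _} () (_ , refl)

  to-W⇒from-U : ∀ {x y} → Adj H x y → IsW y → IsU x
  to-W⇒from-U {x = inj₁ u} _  _         = u , refl
  to-W⇒from-U {x = inj₂ _} () (_ , refl)

  U∩W-empty : ∀ {x} → IsU x → IsW x → ⊥
  U∩W-empty (_ , refl) (_ , ())

  ∈NUnion⁺ : ∀ {k} (vs : Vector (Fin m) k) t {w} → w ∈ N H (vs t) → w ∈ NUnion H vs
  ∈NUnion⁺ vs zero    w∈ = x∈p∪q⁺ (inj₁ w∈)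
  ∈NUnion⁺ vs (suc t) w∈ = x∈p∪q⁺ (inj₂ (∈NUnion⁺ (tail vs) t w∈))

  ∈NUnion⁻ : ∀ {k} (vs : Vector (Fin m) k) {w} → w ∈ NUnion H vs → ∃ λ t → w ∈ N H (vs t)
  ∈NUnion⁻ {zero}  vs w∈ = ⊥-elim (∉⊥ w∈)
  ∈NUnion⁻ {suc k} vs w∈ with x∈p∪q⁻ (N H (vs zero)) (NUnion H (tail vs)) w∈
  ... | inj₁ w∈head = zero , w∈head
  ... | inj₂ w∈tail = let t , w∈ = ∈NUnion⁻ (tail vs) w∈tail in suc t , w∈

  NUnion-removeAt : ∀ {k} (vs : Vector (Fin m) (suc k)) i →
    NUnion H vs ≡ N H (vs i) ∪ NUnion H (removeAt vs i)
  NUnion-removeAt         vs zero    = refl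
  NUnion-removeAt {suc k} vs (suc i) =
    trans (cong (N H (vs zero) ∪_) (NUnion-removeAt (tail vs) i))
          (∪-leftSwap (N H (vs zero)) (N H (vs (suc i))) (NUnion H (removeAt (tail vs) i)))
    where
    open CommutativeSemigroupProperties
           (CommutativeMonoid.commutativeSemigroup (∪-commutativeMonoid n))
      using () renaming (x∙yz≈y∙xz to ∪-leftSwap)

  degSum-removeAt : ∀ {k} (vs : Vector (Fin m) (suc k)) i →
    degSum H vs ≡ ∣ N H (vs i) ∣ + degSum H (removeAt vs i)
  degSum-removeAt         vs zero    = refl
  degSum-removeAt {suc k} vs (suc i) =
    trans (cong (∣ N H (vs zero) ∣ +_) (degSum-removeAt (tail vs) i))
          (+-leftSwap ∣ N H (vs zero) ∣ ∣ N H (vs (suc i)) ∣ (degSum H (removeAt (tail vs) i)))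
    where
    open CommutativeSemigroupProperties +-commutativeSemigroup
      using () renaming (x∙yz≈y∙xz to +-leftSwap)

  Overlap : ∀ {k} → Vector (Fin m) (suc k) → Fin (suc k) → Subset n
  Overlap vs i = N H (vs i) ∩ NUnion H (removeAt vs i)

  removeAt-injective : ∀ {k} (vs : Vector (Fin m) (suc k)) i →
    Injective _≡_ _≡_ vs → Injective _≡_ _≡_ (removeAt vs i)
  removeAt-injective vs i vs-inj eq = punchIn-injective i _ _ (vs-inj eq)

  -- A chain x₀ y₀ x₁ y₁ … x_r in which consecutive xₜ share the neighbour yₜ has
  -- excess at least r: each new xₜ meets the union of the later ones.
  chain-excess : ∀ r (xs : Vector (Fin m) (suc r)) (ys : Vector (Fin n) r) →
    (∀ t → ys t ∈ N H (xs (inject₁ t))) → (∀ t → ys t ∈ N H (xs (suc t))) →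
    ∣ NUnion H xs ∣ + r ≤ degSum H xs
  chain-excess zero    xs ys _    _     =
    ≤-reflexive (cong (λ p → ∣ p ∣ + 0) (∪-identityʳ (N H (xs zero))))
  chain-excess (suc r) xs ys left right =
    excess-cons-≥ (N H (xs zero)) (NUnion H (tail xs)) later-excess meets-later
    where
    later-excess : ∣ NUnion H (tail xs) ∣ + r ≤ degSum H (tail xs)
    later-excess = chain-excess r (tail xs) (tail ys) (left ∘ suc) (right ∘ suc)
    meets-later : 1 ≤ ∣ N H (xs zero) ∩ NUnion H (tail xs) ∣
    meets-later = x∈p⇒1≤∣p∣ (x∈p∩q⁺ (left zero , ∈NUnion⁺ (tail xs) zero (right zero)))

  record ClosedChain (r : ℕ) : Set where
    field
      us            : Vector (Fin m) (suc r)
      ws            : Vector (Fin n) (suc r)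
      us-injective  : Injective _≡_ _≡_ us
      left          : ∀ t → ws t ∈ N H (us t)
      right         : ∀ (t : Fin r) → ws (inject₁ t) ∈ N H (us (suc t))
      closing       : ws (fromℕ r) ∈ N H (us zero)
      ends-distinct : ws zero ≢ ws (fromℕ r)

  -- A closed chain u₀ … u_{r+1} has excess at least r + 2: u₁ … u_{r+1} form a
  -- chain, and u₀ shares the two distinct neighbours w₀ and w_{r+1} with it.
  closedChain-excess : ∀ {r} (C : ClosedChain (suc r)) →
    let open ClosedChain C in ∣ NUnion H us ∣ + suc (suc r) ≤ degSum H us
  closedChain-excess {r} C =
    excess-cons-≥ (N H (us zero)) (NUnion H (tail us)) later-excess meets-later-twice
    where
    open ClosedChain C
    later-excess : ∣ NUnion H (tail us) ∣ + r ≤ degSum H (tail us)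
    later-excess =
      chain-excess r (tail us) (ws ∘ suc ∘ inject₁) (left ∘ suc ∘ inject₁) (right ∘ suc)
    meets-later-twice : 2 ≤ ∣ N H (us zero) ∩ NUnion H (tail us) ∣
    meets-later-twice = x,y∈p⇒2≤∣p∣
      (x∈p∩q⁺ (left zero , ∈NUnion⁺ (tail us) zero (right zero)))
      (x∈p∩q⁺ (closing , ∈NUnion⁺ (tail us) (fromℕ r) (left (fromℕ (suc r)))))
      ends-distinct

  -- A cycle read off along ℕ: positions 0 … l carry distinct vertices,
  -- consecutive positions are adjacent and so are l and 0.  This is IsCycle with
  -- positions as numbers rather than elements of Fin (suc l).
  record CyclePath (v : ℕ → Vertex m n) (l : ℕ) : Set where
    field
      adjacent  : ∀ {t} → t < l → Adj H (v t) (v (suc t))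
      closing   : Adj H (v l) (v 0)
      injective : ∀ {s t} → s ≤ l → t ≤ l → v s ≡ v t → s ≡ t

  CyclePath⇒IsCycle : ∀ {v l} → 2 ≤ l → CyclePath v l → IsCycle H l (v ∘ toℕ)
  CyclePath⇒IsCycle {v} {l} 2≤l path = record
    { long     = 2≤l
    ; distinct = λ {i} {j} eq → toℕ-injective (injective (toℕ≤pred[n] i) (toℕ≤pred[n] j) eq)
    ; step     = λ i → subst (λ t → Adj H (v t) (v (suc (toℕ i))))
                             (sym (toℕ-inject₁ i)) (adjacent (toℕ<n i))
    ; close    = subst (λ t → Adj H (v t) (v 0)) (sym (toℕ-fromℕ l)) closing
    }
    where open CyclePath path

  IsCycle⇒CyclePath : ∀ {l c} → IsCycle H l c → CyclePath (c ∘ clamp l) l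
  IsCycle⇒CyclePath {l} {c} cycle = record
    { adjacent  = adjacent
    ; closing   = subst (λ i → Adj H (c i) (c zero))
                        (sym (clamp-at (fromℕ l) ≤-refl (toℕ-fromℕ l))) close
    ; injective = λ s≤l t≤l eq →
        trans (sym (toℕ-clamp s≤l)) (trans (cong toℕ (distinct eq)) (toℕ-clamp t≤l))
    }
    where
    open IsCycle cycle
    adjacent : ∀ {t} → t < l → Adj H (c (clamp l t)) (c (clamp l (suc t)))
    adjacent {t} t<l = subst₂ (λ i j → Adj H (c i) (c j)) (sym at-t) (sym at-suc-t) (step i)
      where
      i = fromℕ< t<l
      at-t : clamp l t ≡ inject₁ i
      at-t = clamp-at (inject₁ i) (<⇒≤ t<l) (trans (toℕ-inject₁ i) (toℕ-fromℕ< t<l))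
      at-suc-t : clamp l (suc t) ≡ suc i
      at-suc-t = clamp-at (suc i) t<l (cong suc (toℕ-fromℕ< t<l))

  rotate : ∀ {v l} → CyclePath v (suc l) → CyclePath (startAtLast v (suc l)) (suc l)
  rotate {v} {l} path = record
    { adjacent  = λ { {zero} _ → closing ; {suc t} t<l → adjacent (m<n⇒m<1+n (s≤s⁻¹ t<l)) }
    ; closing   = adjacent (n<1+n l)
    ; injective = injective′
    }
    where
    open CyclePath path
    last≢ : ∀ {t} → t ≤ l → v (suc l) ≢ v t
    last≢ t≤l eq = n≮n _ (<-≤-trans (s≤s t≤l)
                     (≤-reflexive (injective ≤-refl (m≤n⇒m≤1+n t≤l) eq)))
    injective′ : ∀ {s t} → s ≤ suc l → t ≤ suc l →
      startAtLast v (suc l) s ≡ startAtLast v (suc l) t → s ≡ t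
    injective′ {zero}  {zero}  _         _         _  = refl
    injective′ {zero}  {suc t} _         (s≤s t≤l) eq = ⊥-elim (last≢ t≤l eq)
    injective′ {suc s} {zero}  (s≤s s≤l) _         eq = ⊥-elim (last≢ s≤l (sym eq))
    injective′ {suc s} {suc t} (s≤s s≤l) (s≤s t≤l) eq =
      cong suc (injective (m≤n⇒m≤1+n s≤l) (m≤n⇒m≤1+n t≤l) eq)

  -- A walk that never steps straight back contains a cycle no longer than the
  -- stretch up to any repeated vertex.
  module NonBacktrackingWalk
    (v : ℕ → Vertex m n)
    (walk-adjacent : ∀ t → Adj H (v t) (v (suc t)))
    (non-backtracking : ∀ t → v (suc (suc t)) ≢ v t)
    where

    NoRepeat : ℕ → Set
    NoRepeat b = ∀ {x y} → x < y → y < b → v x ≢ v y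

    firstRepeat : ∀ b →
      (∃₂ λ x y → x < y × y < b × v x ≡ v y × NoRepeat y) ⊎ NoRepeat b
    firstRepeat zero = inj₂ λ _ ()
    firstRepeat (suc b) with firstRepeat b
    ... | inj₁ (x , y , x<y , y<b , eq , fresh) =
      inj₁ (x , y , x<y , m<n⇒m<1+n y<b , eq , fresh)
    ... | inj₂ fresh with anyUpTo? (λ x → ≡-dec _≟ᶠ_ _≟ᶠ_ (v x) (v b)) b
    ...   | yes (x , x<b , eq) = inj₁ (x , b , x<b , ≤-refl , eq , fresh)
    ...   | no  new            = inj₂ extended
      where
      extended : NoRepeat (suc b)
      extended x<y y<b+1 with m<1+n⇒m<n∨m≡n y<b+1
      ... | inj₁ y<b  = fresh x<y y<b
      ... | inj₂ refl = λ eq → new (_ , x<y , eq)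

    -- The stretch from x to x + l + 1 = y, free of inner repetitions, is a cycle;
    -- l ≥ 2 because H has no loops and the walk does not backtrack.
    segment-cycle : ∀ {x y} l → x + suc l ≡ y → v x ≡ v y → NoRepeat y →
      ∃ λ c → IsCycle H l c
    segment-cycle {x} l refl closes fresh = _ , CyclePath⇒IsCycle (length≥2 l closes) path
      where
      path : CyclePath (v ∘ (x +_)) l
      path = record
        { adjacent  = λ {t} _ → subst (λ z → Adj H (v (x + t)) (v z))
                                      (sym (+-suc x t)) (walk-adjacent (x + t))
        ; closing   = subst (Adj H (v (x + l)))
                            (trans (cong v (sym (+-suc x l)))
                                   (trans (sym closes) (cong v (sym (+-identityʳ x)))))
                            (walk-adjacent (x + l))
        ; injective = injective
        }
        where
        injective : ∀ {s t} → s ≤ l → t ≤ l → v (x + s) ≡ v (x + t) → s ≡ t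
        injective {s} {t} s≤l t≤l eq with <-cmp s t
        ... | tri< s<t _ _ = ⊥-elim (fresh (+-monoʳ-< x s<t) (+-monoʳ-< x (s≤s t≤l)) eq)
        ... | tri≈ _ s≡t _ = s≡t
        ... | tri> _ _ t<s = ⊥-elim (fresh (+-monoʳ-< x t<s) (+-monoʳ-< x (s≤s s≤l)) (sym eq))
      length≥2 : ∀ k → v x ≡ v (x + suc k) → 2 ≤ k
      length≥2 zero eq = ⊥-elim (Adj-irrefl (v x)
        (subst (Adj H (v x)) (trans (cong v (+-comm 1 x)) (sym eq)) (walk-adjacent x)))
      length≥2 (suc zero) eq =
        ⊥-elim (non-backtracking x (trans (cong v (+-comm 2 x)) (sym eq)))
      length≥2 (suc (suc k)) _ = s≤s (s≤s z≤n)

    repeat⇒cycle : ∀ {a b} → a < b → v a ≡ v b →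
      ∃₂ λ l c → IsCycle H l c × suc l ≤ b
    repeat⇒cycle {a} {b} a<b eq with firstRepeat (suc b)
    ... | inj₂ fresh = ⊥-elim (fresh a<b ≤-refl eq)
    ... | inj₁ (x , y , x<y , y≤b , eq′ , fresh′) =
      let c , cycle = segment-cycle l length eq′ fresh′
      in l , c , cycle , ≤-trans (m≤n+m (suc l) x) (≤-trans (≤-reflexive length) (s≤s⁻¹ y≤b))
      where
      l = y ∸ suc x
      length : x + suc l ≡ y
      length = trans (+-suc x l) (m+[n∸m]≡n x<y)

  -- If each of j + 1 distinct vertices u₀ … u_j shares at least two neighbours
  -- with the others, then H has a cycle of length at most 2(j + 1).
  module SharedNeighbourWalk {j}
    (us : Vector (Fin m) (suc j))
    (us-injective : Injective _≡_ _≡_ us)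
    (overlaps : ∀ i → 2 ≤ ∣ Overlap us i ∣)
    where

    -- A state of the walk: a vertex us i and a neighbour of it shared with another uᵢ.
    record Position : Set where
      field
        index     : Fin (suc j)
        shared    : Fin n
        shared∈   : shared ∈ Overlap us index
    open Position

    partner : (p : Position) → ∃ λ i → i ≢ index p × shared p ∈ N H (us i)
    partner p =
      let t , w∈ = ∈NUnion⁻ (removeAt us (index p)) (proj₂ (x∈p∩q⁻ _ _ (shared∈ p)))
      in punchIn (index p) t , punchInᵢ≢i (index p) t , w∈

    onward : (p : Position) → ∃ λ w → w ∈ Overlap us (proj₁ (partner p)) × w ≢ shared p
    onward p = 2≤∣p∣⇒avoid _ (shared p) (overlaps (proj₁ (partner p)))

    next : Position → Position
    next p = record
      { index   = proj₁ (partner p)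
      ; shared  = proj₁ (onward p)
      ; shared∈ = proj₁ (proj₂ (onward p))
      }

    start : Position
    start = let w , w∈ = 1≤∣p∣⇒nonempty _ (≤-trans (n≤1+n 1) (overlaps zero))
            in record { index = zero ; shared = w ; shared∈ = w∈ }

    walk : Position → ℕ → Vertex m n
    walk p zero          = inj₁ (us (index p))
    walk p (suc zero)    = inj₂ (shared p)
    walk p (suc (suc t)) = walk (next p) t

    walk-adjacent : ∀ p t → Adj H (walk p t) (walk p (suc t))
    walk-adjacent p zero          = proj₁ (x∈p∩q⁻ _ _ (shared∈ p))
    walk-adjacent p (suc zero)    = proj₂ (proj₂ (partner p))
    walk-adjacent p (suc (suc t)) = walk-adjacent (next p) t

    walk-non-backtracking : ∀ p t → walk p (suc (suc t)) ≢ walk p t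
    walk-non-backtracking p zero          eq =
      proj₁ (proj₂ (partner p)) (us-injective (inj₁-injective eq))
    walk-non-backtracking p (suc zero)    eq = proj₂ (proj₂ (onward p)) (inj₂-injective eq)
    walk-non-backtracking p (suc (suc t))    = walk-non-backtracking (next p) t

    walk-double : ∀ p t → walk p (double t) ≡ inj₁ (us (index (iterate next p t)))
    walk-double p zero    = refl
    walk-double p (suc t) = walk-double (next p) t

    -- Among the first j + 2 positions two have the same index (pigeonhole).
    short-cycle : ∃₂ λ l c → IsCycle H l c × suc l ≤ double (suc j)
    short-cycle =
      let t₁ , t₂ , t₁<t₂ , same = pigeonhole (n<1+n (suc j)) visited
          l , c , cycle , l<2t₂ = repeat⇒cycle (double-mono-< t₁<t₂)
            (trans (walk-double start (toℕ t₁))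
              (trans (cong (inj₁ ∘ us) same) (sym (walk-double start (toℕ t₂)))))
      in l , c , cycle , ≤-trans l<2t₂ (double-mono-≤ (toℕ≤pred[n] t₂))
      where
      open NonBacktrackingWalk (walk start) (walk-adjacent start) (walk-non-backtracking start)
      visited : Fin (suc (suc j)) → Fin (suc j)
      visited t = index (iterate next start (toℕ t))

  low-overlap : ∀ {j} (us : Vector (Fin m) (suc j)) → Injective _≡_ _≡_ us →
    GirthAtLeast H (suc (double (suc j))) → ∃ λ i → ∣ Overlap us i ∣ ≤ 1
  low-overlap us us-injective girth with any? (λ i → ∣ Overlap us i ∣ ≤? 1)
  ... | yes found = found
  ... | no  none  =
    let l , c , cycle , short = SharedNeighbourWalk.short-cycle us us-injective
                                  (λ i → ≮⇒≥ (λ ≤1 → none (i , s≤s⁻¹ ≤1)))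
    in ⊥-elim (≤⇒≯ short (girth l c cycle))

  -- (⇒) Girth at least 2g + 2 gives the excess bound for up to g distinct vertices:
  -- remove a vertex of low overlap and use induction.
  excess-bound : ∀ g → GirthAtLeast H (2 * g + 2) →
    ∀ k → suc k ≤ g → (us : Vector (Fin m) (suc k)) → Injective _≡_ _≡_ us →
    degSum H us ≤ ∣ NUnion H us ∣ + k
  excess-bound g girth zero _ us _ =
    ≤-reflexive (cong (λ p → ∣ p ∣ + 0) (sym (∪-identityʳ (N H (us zero)))))
  excess-bound g girth (suc k) k+2≤g us us-injective =
    let i , small = low-overlap us us-injective
                      (λ l c cycle → ≤-trans below-girth (girth l c cycle))
        rest = removeAt us i
        rest-excess = excess-bound g girth k (≤-trans (n≤1+n _) k+2≤g) rest
                        (removeAt-injective us i us-injective)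
    in begin
      degSum H us                                ≡⟨ degSum-removeAt us i ⟩
      ∣ N H (us i) ∣ + degSum H rest             ≤⟨ excess-cons-≤ (N H (us i)) (NUnion H rest)
                                                      rest-excess small ⟩
      ∣ N H (us i) ∪ NUnion H rest ∣ + suc k     ≡⟨ cong (λ p → ∣ p ∣ + suc k)
                                                      (NUnion-removeAt us i) ⟨
      ∣ NUnion H us ∣ + suc k                    ∎
    where
    open ≤-Reasoning
    below-girth : suc (double (suc (suc k))) ≤ 2 * g + 2
    below-girth =
      ≤-trans (s≤s (double-mono-≤ k+2≤g)) (≤-trans (n≤1+n _) (≤-reflexive (double-suc g)))

  module Alternation {v l} (path : CyclePath v l) (starts-in-U : IsU (v 0)) where
    open CyclePath path

    even-in-U : ∀ s → double s ≤ l → IsU (v (double s))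
    odd-in-W  : ∀ s → suc (double s) ≤ l → IsW (v (suc (double s)))
    even-in-U zero    _      = starts-in-U
    even-in-U (suc s) 2s+2≤l =
      from-W⇒to-U (adjacent 2s+2≤l) (odd-in-W s (≤-trans (n≤1+n _) 2s+2≤l))
    odd-in-W  s       2s+1≤l =
      from-U⇒to-W (adjacent 2s+1≤l) (even-in-U s (≤-trans (n≤1+n _) 2s+1≤l))

    odd-last : ∃ λ q → l ≡ suc (double q)
    odd-last with parity l
    ... | q , inj₂ odd  = q , odd
    ... | q , inj₁ even = ⊥-elim (U∩W-empty starts-in-U
      (from-U⇒to-W closing (subst (IsU ∘ v) (sym even) (even-in-U q (≤-reflexive (sym even))))))

    closedChain : ∀ r → l ≡ suc (double (suc r)) → ClosedChain (suc r)
    closedChain r last = record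
      { us            = us
      ; ws            = ws
      ; us-injective  = λ {s} {s′} eq → toℕ-injective (double-injective (injective
          (u-bound s) (u-bound s′) (trans (at-us s) (trans (cong inj₁ eq) (sym (at-us s′))))))
      ; left          = λ s → subst₂ (Adj H) (at-us s) (at-ws s) (adjacent (w-bound s))
      ; right         = right
      ; closing       = subst₂ (Adj H) at-last (at-us zero) closing
      ; ends-distinct = λ eq → 1≢l (injective (w-bound zero) ≤-refl
          (trans (at-ws zero) (trans (cong inj₂ eq) (sym at-last))))
      }
      where
      R = suc r
      u-bound : (s : Fin (suc R)) → double (toℕ s) ≤ l
      u-bound s =
        ≤-trans (double-mono-≤ (toℕ≤pred[n] s)) (≤-trans (n≤1+n _) (≤-reflexive (sym last)))
      w-bound : (s : Fin (suc R)) → suc (double (toℕ s)) ≤ l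
      w-bound s = ≤-trans (s≤s (double-mono-≤ (toℕ≤pred[n] s))) (≤-reflexive (sym last))
      us : Vector (Fin m) (suc R)
      us s = proj₁ (even-in-U (toℕ s) (u-bound s))
      at-us : ∀ s → v (double (toℕ s)) ≡ inj₁ (us s)
      at-us s = proj₂ (even-in-U (toℕ s) (u-bound s))
      ws : Vector (Fin n) (suc R)
      ws s = proj₁ (odd-in-W (toℕ s) (w-bound s))
      at-ws : ∀ s → v (suc (double (toℕ s))) ≡ inj₂ (ws s)
      at-ws s = proj₂ (odd-in-W (toℕ s) (w-bound s))
      at-last : v l ≡ inj₂ (ws (fromℕ R))
      at-last =
        trans (cong v (trans last (cong (suc ∘ double) (sym (toℕ-fromℕ R))))) (at-ws (fromℕ R))
      1≢l : 1 ≢ l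
      1≢l eq with trans eq last
      ... | ()
      right : ∀ (t : Fin R) → ws (inject₁ t) ∈ N H (us (suc t))
      right t = subst₂ (Adj H) (at-ws (inject₁ t))
        (trans (cong (λ z → v (double (suc z))) (toℕ-inject₁ t)) (at-us (suc t)))
        (adjacent (subst (λ z → double (suc z) ≤ l) (sym (toℕ-inject₁ t)) (u-bound (suc t))))

  orient : ∀ {v l} → CyclePath v (suc l) → ∃ λ v′ → CyclePath v′ (suc l) × IsU (v′ 0)
  orient {v} path with side (v 0)
  ... | inj₁ u₀ = v , path , u₀
  ... | inj₂ w₀ = _ , rotate path , to-W⇒from-U (CyclePath.closing path) w₀

  cycle⇒closedChain : ∀ {l c} → IsCycle H l c →
    ∃ λ r → suc l ≡ double (suc (suc r)) × ClosedChain (suc r)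
  cycle⇒closedChain {zero}  cycle = contradiction (IsCycle.long cycle) λ ()
  cycle⇒closedChain {suc l} cycle with orient (IsCycle⇒CyclePath cycle)
  ... | v , path , starts-in-U with Alternation.odd-last path starts-in-U
  ...   | zero  , last = contradiction (subst (2 ≤_) last (IsCycle.long cycle)) λ { (s≤s ()) }
  ...   | suc r , last = r , cong suc last , Alternation.closedChain path starts-in-U r last

  girth-bound : ∀ g →
    ((k : ℕ) → suc k ≤ g → (us : Vector (Fin m) (suc k)) → Injective _≡_ _≡_ us →
      degSum H us ≤ ∣ NUnion H us ∣ + k) →
    GirthAtLeast H (2 * g + 2)
  girth-bound g bound l c cycle = ≮⇒≥ λ short →
    let r , length , C = cycle⇒closedChain cycle
        open ClosedChain C
        few : suc (suc r) ≤ g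
        few = s≤s⁻¹ (double-cancel-< (subst₂ _<_ length (sym (double-suc g)) short))
    in n≮n (suc r) (+-cancelˡ-≤ ∣ NUnion H us ∣ _ _
         (≤-trans (closedChain-excess C) (bound (suc r) few us us-injective)))

lemma17 : ∀ {m n : ℕ} (H : BipGraph m n) (g : ℕ) →
  GirthAtLeast H (2 * g + 2) ⇔
    ((k : ℕ) → suc k ≤ g → (us : Vector (Fin m) (suc k)) → Injective _≡_ _≡_ us →
      degSum H us ≤ ∣ NUnion H us ∣ + k)
lemma17 H g = mk⇔ (excess-bound H g) (girth-bound H g)
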